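{- For all integers $v\ge4$ and $d\ge1$, $\left|\mathcal{D}_{v,d}(231, 312)\right| = 2^{d(v-2)-1}$.
   Context: A diamond with $v$ vertices ($v\ge4$) is the poset with a least element, a greatest element, and $v-2$ pairwise incomparable middle elements (in a fixed left-to-right order) strictly between them. $\mathcal{D}_{v,d}$ is the set of labellings of $d$ diamonds (placed left to right) by $1,\dots,vd$, each label used once, such that in each diamond least label $<$ each middle label $<$ greatest label. For $D\in\mathcal{D}_{v,d}$, $\pi_D$ is the permutation obtained by reading the diamonds left to right and, within each diamond, the least element, then the middle elements left to right, then the greatest element. $\mathcal{D}_{v,d}(P)$ is the set of $D$ with $\pi_D$ avoiding every classical pattern in $P$. -}

module Defs where

open import Data.Nat using (ℕ; _*_; _∸_; _^_; _<_)
open import Data.Fin using (Fin; toℕ; combine)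
import Data.Fin as F
open import Data.Vec using (Vec; lookup)
open import Data.Product using (∃; _×_; Σ-syntax)
open import Data.List using (List; length)
open import Data.List.Membership.Propositional using (_∈_)
import Data.List.Relation.Unary.Unique.Propositional as LU
import Data.Vec.Relation.Unary.Unique.Propositional as VU
open import Function.Bundles using (_⇔_)
open import Relation.Binary.PropositionalEquality using (_≡_)
open import Relation.Nullary using (¬_)

-- A word of length n over the label set Fin n (label ℓ stands for ℓ+1 ∈ {1,…,n}).
-- It is a permutation (in one-line notation) iff its entries are pairwise distinct.
IsPerm : ∀ {n} → Vec (Fin n) n → Set
IsPerm w = VU.Unique w

Contains231 : ∀ {n} → Vec (Fin n) n → Set
Contains231 {n} w = ∃ λ (a : Fin n) → ∃ λ (b : Fin n) → ∃ λ (c : Fin n) →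
  a F.< b × b F.< c × lookup w c F.< lookup w a × lookup w a F.< lookup w b

Contains312 : ∀ {n} → Vec (Fin n) n → Set
Contains312 {n} w = ∃ λ (a : Fin n) → ∃ λ (b : Fin n) → ∃ λ (c : Fin n) →
  a F.< b × b F.< c × lookup w b F.< lookup w c × lookup w c F.< lookup w a

-- Labelled diamonds: d diamonds with v vertices each, positions of diamond k
-- are k*v + 0 (least), k*v + 1 … k*v + (v-2) (middles, left to right),
-- k*v + (v-1) (greatest).  A labelling D is identified with its reading word
-- π_D : the label at diamond k, slot i is  lookup π (combine k i).
IsDiamondLabelling : (v d : ℕ) → Vec (Fin (d * v)) (d * v) → Set
IsDiamondLabelling v d w =
  IsPerm w ×
  (∀ (k : Fin d) (i j : Fin v) → toℕ i ≡ 0 → 0 < toℕ j → toℕ j < v ∸ 1 →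
     lookup w (combine k i) F.< lookup w (combine k j)) ×
  (∀ (k : Fin d) (i j : Fin v) → 0 < toℕ i → toℕ i < v ∸ 1 → toℕ j ≡ v ∸ 1 →
     lookup w (combine k i) F.< lookup w (combine k j))

InD-231-312 : (v d : ℕ) → Vec (Fin (d * v)) (d * v) → Set
InD-231-312 v d w = IsDiamondLabelling v d w × ¬ Contains231 w × ¬ Contains312 w

HasCard : {A : Set} → (A → Set) → ℕ → Set
HasCard {A} S m = Σ[ L ∈ List A ] (LU.Unique L × (∀ x → (x ∈ L) ⇔ S x) × length L ≡ m)

module Submission where

-- A permutation avoids 231 and 312 iff it is layered: it splits into blocks of consecutive
-- positions, each block is a decreasing run, and every block uses larger values than the
-- blocks before it.  Such a permutation is determined by the positions where its blocks
-- start, which are exactly its ascent tops, and any set of such positions occurs.  For a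
-- layered labelling of d diamonds with v vertices, least < middle and middle < greatest
-- say precisely that a block starts at the first middle and at the greatest element of each
-- diamond.  This fixes 2d of the n - 1 = dv - 1 non-initial positions and leaves the other
-- d(v - 2) - 1 free, giving 2^(d(v-2)-1) labellings.

open import Defs

open import Data.Bool.Base using (Bool; true; false; if_then_else_; b≤b; f≤t)
import Data.Bool.Base as Bool
open import Data.Empty using (⊥-elim)
open import Data.Fin.Base using (Fin; toℕ; fromℕ<; combine; remQuot)
import Data.Fin.Base as F
open import Data.Fin.Properties using (toℕ-injective; toℕ<n; toℕ-fromℕ<; toℕ-fromℕ; toℕ-combine; combine-remQuot; toℕ-↑ˡ)
open import Data.List.Base using (List; []; _∷_; length)
import Data.List.Base as List
open import Data.List.Membership.Propositional using (_∈_)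
open import Data.List.Membership.Propositional.Properties using (∈-map⁺; ∈-map⁻; ∈-++⁺ˡ; ∈-++⁺ʳ; ∈-++⁻)
open import Data.List.Properties using (length-map; length-++; map-∘; map-id-local)
open import Data.List.Relation.Unary.All using ([])
import Data.List.Relation.Unary.All as All
open import Data.List.Relation.Unary.AllPairs using ([]; _∷_)
open import Data.List.Relation.Unary.Any using (here)
import Data.List.Relation.Unary.Unique.Propositional as ListUnique
import Data.List.Relation.Unary.Unique.Propositional.Properties as ListUnique
open import Data.Nat.Base
open import Data.Nat.Properties
open import Data.Product.Base using (∃; _×_; _,_; proj₁; proj₂)
open import Data.Sum.Base using (_⊎_; inj₁; inj₂)
open import Data.Vec.Base using (Vec; []; _∷_; _++_; _∷ʳ_; lookup; map; replicate; tabulate)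
open import Data.Vec.Properties using (lookup-map; lookup∘tabulate; ∷-injectiveʳ; lookup-++ˡ; lookup-++ʳ)
open import Data.Vec.Relation.Binary.Pointwise.Extensional using (ext; extensional⇒inductive)
open import Data.Vec.Relation.Binary.Pointwise.Inductive using (Pointwise; []; _∷_)
import Data.Vec.Relation.Binary.Pointwise.Inductive as Pointwise
import Data.Vec.Relation.Unary.Unique.Propositional.Properties as VecUnique
open import Function.Base using (_∘_)
open import Function.Bundles using (_⇔_; mk⇔)
open import Relation.Binary.Definitions using (tri<; tri≈; tri>)
open import Relation.Binary.PropositionalEquality
open import Relation.Nullary.Decidable using (yes; no; does; dec-true; dec-false)
open import Relation.Nullary.Negation using (¬_)

strictlyIncreasing-selfMap-id : ∀ {n} (h : ℕ → ℕ) →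
  (∀ {x y} → x < y → y < n → h x < h y) → (∀ {x} → x < n → h x < n) →
  ∀ {x} → x < n → h x ≡ x
strictlyIncreasing-selfMap-id {n} h increasing bounded {x} x<n =
  ≤-antisym h[x]≤x x≤h[x]
  where
  shift : ∀ x k → x + k < n → h x + k ≤ h (x + k)
  shift x zero    _ = ≤-reflexive (trans (+-identityʳ (h x)) (cong h (sym (+-identityʳ x))))
  shift x (suc k) l = begin
    h x + suc k      ≡⟨ +-suc (h x) k ⟩
    suc (h x + k)    ≤⟨ s≤s (shift x k (<-trans step l)) ⟩
    suc (h (x + k))  ≤⟨ increasing step l ⟩
    h (x + suc k)    ∎
    where
    open ≤-Reasoning
    step : x + k < x + suc k
    step = +-monoʳ-< x (n<1+n k)
  x≤h[x] : x ≤ h x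
  x≤h[x] = ≤-trans (m≤n+m x (h 0)) (shift 0 x x<n)
  h[x]≤x : h x ≤ x
  h[x]≤x with m≤n⇒∃[o]m+o≡n x<n
  ... | k , refl = ≤-pred (+-cancelʳ-< k (h x) (suc x) (≤-<-trans (shift x k x+k<n) (bounded x+k<n)))
    where
    x+k<n : x + k < suc x + k
    x+k<n = n<1+n (x + k)

reflect-involutive : ∀ {a p N} → a ≤ p → p < N → a + (N ∸ suc (a + (N ∸ suc p))) ≡ p
reflect-involutive {a} a≤p p<N with m≤n⇒∃[o]m+o≡n a≤p
... | u , refl with m≤n⇒∃[o]m+o≡n p<N
... | t , refl = begin
  a + (suc (a + u) + t ∸ suc (a + (suc (a + u) + t ∸ suc (a + u))))
    ≡⟨ cong (λ z → a + (suc (a + u) + t ∸ suc (a + z))) (m+n∸m≡n (suc (a + u)) t) ⟩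
  a + (a + u + t ∸ (a + t))
    ≡⟨ cong (λ z → a + (z ∸ (a + t))) swap ⟩
  a + (a + t + u ∸ (a + t))
    ≡⟨ cong (a +_) (m+n∸m≡n (a + t) u) ⟩
  a + u ∎
  where
  open ≡-Reasoning
  swap : a + u + t ≡ a + t + u
  swap = trans (+-assoc a u t) (trans (cong (a +_) (+-comm u t)) (sym (+-assoc a t u)))

Pattern231 Pattern312 : ℕ → ℕ → ℕ → Set
Pattern231 x y z = z < x × x < y
Pattern312 x y z = y < z × z < x

Avoids : ℕ → (ℕ → ℕ → ℕ → Set) → (ℕ → ℕ) → Set
Avoids n P f = ∀ {a b c} → a < b → b < c → c < n → ¬ P (f a) (f b) (f c)

InjectiveBelow : ℕ → (ℕ → ℕ) → Set
InjectiveBelow n f = ∀ {a b} → a < n → b < n → f a ≡ f b → a ≡ b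

ascentAt : (ℕ → ℕ) → ℕ → Bool
ascentAt f zero    = true
ascentAt f (suc i) = does (f i <? f (suc i))

-- cut i means that a new block starts at position i; positions ≥ n count as cuts, so the last
-- block ends at n.  layered reverses every block [blockStart p, nextCut p) in place.
module Layered (n : ℕ) (cut : ℕ → Bool) (cut-beyond : ∀ {i} → n ≤ i → cut i ≡ true) where

  blockStart : ℕ → ℕ
  blockStart zero    = zero
  blockStart (suc p) = if cut (suc p) then suc p else blockStart p

  firstCutFrom : (fuel i : ℕ) → ℕ
  firstCutFrom zero       i = i
  firstCutFrom (suc fuel) i = if cut i then i else firstCutFrom fuel (suc i)

  nextCut : ℕ → ℕ
  nextCut p = firstCutFrom n (suc p)

  layered : ℕ → ℕ
  layered p = blockStart p + (nextCut p ∸ suc p)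

  Separated : ℕ → ℕ → Set
  Separated p q = ∃ λ i → p < i × i ≤ q × cut i ≡ true

  CutFree : ℕ → ℕ → Set
  CutFree p q = ∀ {j} → p < j → j ≤ q → cut j ≡ false

  IsFirstCutFrom : ℕ → ℕ → Set
  IsFirstCutFrom i r = i ≤ r × cut r ≡ true × (∀ {j} → i ≤ j → j < r → cut j ≡ false)

  cutFree-trans : ∀ {a b c} → CutFree a b → CutFree b c → CutFree a c
  cutFree-trans {b = b} ab bc {j} a<j j≤c with j ≤? b
  ... | yes j≤b = ab a<j j≤b
  ... | no  j≰b = bc (≰⇒> j≰b) j≤c

  blockStart-≤ : ∀ p → blockStart p ≤ p
  blockStart-≤ zero = z≤n
  blockStart-≤ (suc p) with cut (suc p)
  ... | true  = ≤-refl
  ... | false = m≤n⇒m≤1+n (blockStart-≤ p)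

  blockStart-isCut : ∀ p → blockStart p ≡ 0 ⊎ cut (blockStart p) ≡ true
  blockStart-isCut zero = inj₁ refl
  blockStart-isCut (suc p) with cut (suc p) in eq
  ... | true  = inj₂ eq
  ... | false = blockStart-isCut p

  blockStart-cutFree : ∀ p → CutFree (blockStart p) p
  blockStart-cutFree zero    s<j j≤0 = ⊥-elim (<⇒≱ s<j j≤0)
  blockStart-cutFree (suc p) s<j j≤1+p with cut (suc p) in eq
  ... | true  = ⊥-elim (<⇒≱ s<j j≤1+p)
  ... | false with m≤n⇒m<n∨m≡n j≤1+p
  ...   | inj₁ j<1+p = blockStart-cutFree p s<j (≤-pred j<1+p)
  ...   | inj₂ refl  = eq

  cut⇒≤blockStart : ∀ {i} q → cut i ≡ true → i ≤ q → i ≤ blockStart q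
  cut⇒≤blockStart zero    _     i≤0   = i≤0
  cut⇒≤blockStart (suc q) cut-i i≤1+q with cut (suc q) in eq
  ... | true  = i≤1+q
  ... | false with m≤n⇒m<n∨m≡n i≤1+q
  ...   | inj₁ i<1+q = cut⇒≤blockStart q cut-i (≤-pred i<1+q)
  ...   | inj₂ refl with () ← trans (sym cut-i) eq

  blockStart-unique : ∀ {s} q → s ≤ q → s ≡ 0 ⊎ cut s ≡ true → CutFree s q → blockStart q ≡ s
  blockStart-unique zero    z≤n  _ _ = refl
  blockStart-unique (suc q) s≤1+q start free with m≤n⇒m<n∨m≡n s≤1+q
  ... | inj₁ s<1+q rewrite free s<1+q ≤-refl =
    blockStart-unique q (≤-pred s<1+q) start (λ s<j j≤q → free s<j (m≤n⇒m≤1+n j≤q))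
  ... | inj₂ refl with start
  ...   | inj₂ cut-s rewrite cut-s = refl

  isFirstCutFrom-step : ∀ {i r} → cut i ≡ false → IsFirstCutFrom (suc i) r → IsFirstCutFrom i r
  isFirstCutFrom-step {i} {r} no-cut (i<r , cut-r , before) = <⇒≤ i<r , cut-r , before′
    where
    before′ : ∀ {j} → i ≤ j → j < r → cut j ≡ false
    before′ i≤j j<r with m≤n⇒m<n∨m≡n i≤j
    ... | inj₁ i<j = before i<j j<r
    ... | inj₂ refl = no-cut

  firstCutFrom-isFirst : ∀ fuel i → n ≤ i + fuel → IsFirstCutFrom i (firstCutFrom fuel i)
  firstCutFrom-isFirst zero i n≤i+0 =
    ≤-refl , cut-beyond (subst (n ≤_) (+-identityʳ i) n≤i+0) , λ i≤j j<i → ⊥-elim (<⇒≱ j<i i≤j)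
  firstCutFrom-isFirst (suc fuel) i bound with cut i in eq
  ... | true  = ≤-refl , eq , λ i≤j j<i → ⊥-elim (<⇒≱ j<i i≤j)
  ... | false = isFirstCutFrom-step eq
                  (firstCutFrom-isFirst fuel (suc i) (subst (n ≤_) (+-suc i fuel) bound))

  isFirstCutFrom-≤ : ∀ {i r j} → IsFirstCutFrom i r → i ≤ j → cut j ≡ true → r ≤ j
  isFirstCutFrom-≤ {r = r} {j} (_ , _ , before) i≤j cut-j with r ≤? j
  ... | yes r≤j = r≤j
  ... | no  r≰j with () ← trans (sym cut-j) (before i≤j (≰⇒> r≰j))

  isFirstCutFrom-unique : ∀ {i r r′} → IsFirstCutFrom i r → IsFirstCutFrom i r′ → r ≡ r′
  isFirstCutFrom-unique first@(i≤r , cut-r , _) first′@(i≤r′ , cut-r′ , _) =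
    ≤-antisym (isFirstCutFrom-≤ first i≤r′ cut-r′) (isFirstCutFrom-≤ first′ i≤r cut-r)

  nextCut-isFirst : ∀ p → IsFirstCutFrom (suc p) (nextCut p)
  nextCut-isFirst p = firstCutFrom-isFirst n (suc p) (≤-trans (m≤n+m n p) (n≤1+n (p + n)))

  p<nextCut : ∀ p → p < nextCut p
  p<nextCut p = proj₁ (nextCut-isFirst p)

  nextCut-isCut : ∀ p → cut (nextCut p) ≡ true
  nextCut-isCut p = proj₁ (proj₂ (nextCut-isFirst p))

  nextCut-cutFree : ∀ p {j} → p < j → j < nextCut p → cut j ≡ false
  nextCut-cutFree p = proj₂ (proj₂ (nextCut-isFirst p))

  nextCut-≤ : ∀ {p} → p < n → nextCut p ≤ n
  nextCut-≤ {p} p<n = isFirstCutFrom-≤ (nextCut-isFirst p) p<n (cut-beyond ≤-refl)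

  block-cutFree : ∀ p {j} → blockStart p < j → j < nextCut p → cut j ≡ false
  block-cutFree p {j} s<j j<N with j ≤? p
  ... | yes j≤p = blockStart-cutFree p s<j j≤p
  ... | no  j≰p = nextCut-cutFree p (≰⇒> j≰p) j<N

  layered<nextCut : ∀ p → layered p < nextCut p
  layered<nextCut p = begin-strict
    blockStart p + (nextCut p ∸ suc p) ≤⟨ +-monoˡ-≤ _ (blockStart-≤ p) ⟩
    p + (nextCut p ∸ suc p)            <⟨ n<1+n _ ⟩
    suc p + (nextCut p ∸ suc p)        ≡⟨ m+[n∸m]≡n (p<nextCut p) ⟩
    nextCut p                          ∎
    where open ≤-Reasoning

  layered-< : ∀ {p} → p < n → layered p < n
  layered-< {p} p<n = <-≤-trans (layered<nextCut p) (nextCut-≤ p<n)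

  layered-separated : ∀ {p q} → Separated p q → layered p < layered q
  layered-separated {p} {q} (i , p<i , i≤q , cut-i) = begin-strict
    layered p    <⟨ layered<nextCut p ⟩
    nextCut p    ≤⟨ isFirstCutFrom-≤ (nextCut-isFirst p) p<i cut-i ⟩
    i            ≤⟨ cut⇒≤blockStart q cut-i i≤q ⟩
    blockStart q ≤⟨ m≤m+n _ _ ⟩
    layered q    ∎
    where open ≤-Reasoning

  layered-cutFree : ∀ {p q} → p < q → CutFree p q → layered q < layered p
  layered-cutFree {p} {q} p<q free = begin-strict
    blockStart q + (nextCut q ∸ suc q) ≡⟨ cong₂ (λ s r → s + (r ∸ suc q)) sameStart sameNext ⟩
    blockStart p + (nextCut p ∸ suc q) <⟨ +-monoʳ-< (blockStart p) (∸-monoʳ-< (s≤s p<q) q<N) ⟩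
    blockStart p + (nextCut p ∸ suc p) ∎
    where
    open ≤-Reasoning
    q<N : q < nextCut p
    q<N with q <? nextCut p
    ... | yes q<N = q<N
    ... | no  q≮N with () ← trans (sym (nextCut-isCut p)) (free (p<nextCut p) (≮⇒≥ q≮N))
    sameNext : nextCut q ≡ nextCut p
    sameNext = isFirstCutFrom-unique (nextCut-isFirst q)
      (q<N , nextCut-isCut p ,
       λ q<j j<N → nextCut-cutFree p (<-trans p<q q<j) j<N)
    sameStart : blockStart q ≡ blockStart p
    sameStart = blockStart-unique q (≤-trans (blockStart-≤ p) (<⇒≤ p<q)) (blockStart-isCut p)
                  (cutFree-trans (blockStart-cutFree p) free)

  layered-involutive : ∀ p → layered (layered p) ≡ p
  layered-involutive p = begin
    blockStart x + (nextCut x ∸ suc x) ≡⟨ cong₂ (λ s r → s + (r ∸ suc x)) sameStart sameNext ⟩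
    blockStart p + (nextCut p ∸ suc x) ≡⟨ reflect-involutive (blockStart-≤ p) (p<nextCut p) ⟩
    p                                  ∎
    where
    open ≡-Reasoning
    x = layered p
    sameStart : blockStart x ≡ blockStart p
    sameStart = blockStart-unique x (m≤m+n _ _) (blockStart-isCut p)
                  (λ s<j j≤x → block-cutFree p s<j (≤-<-trans j≤x (layered<nextCut p)))
    sameNext : nextCut x ≡ nextCut p
    sameNext = isFirstCutFrom-unique (nextCut-isFirst x)
      (layered<nextCut p , nextCut-isCut p ,
       λ x<j j<N → block-cutFree p (≤-<-trans (m≤m+n _ _) x<j) j<N)

  layered-injective : ∀ {a b} → layered a ≡ layered b → a ≡ b
  layered-injective {a} {b} eq = begin
    a                     ≡⟨ layered-involutive a ⟨
    layered (layered a)   ≡⟨ cong layered eq ⟩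
    layered (layered b)   ≡⟨ layered-involutive b ⟩
    b                     ∎
    where open ≡-Reasoning

  layered-ascentAt : ∀ i → ascentAt layered (suc i) ≡ cut (suc i)
  layered-ascentAt i = ascentIf (cut (suc i)) refl
    where
    ascentIf : ∀ b → cut (suc i) ≡ b → ascentAt layered (suc i) ≡ b
    ascentIf true  cut-1+i = dec-true (_ <? _) (layered-separated (suc i , n<1+n i , ≤-refl , cut-1+i))
    ascentIf false cut-1+i = dec-false (_ <? _) (<-asym (layered-cutFree (n<1+n i) cutFree))
      where
      cutFree : CutFree i (suc i)
      cutFree i<j j≤1+i rewrite ≤-antisym j≤1+i i<j = cut-1+i

  separated-weakenˡ : ∀ {o p q} → o ≤ p → Separated p q → Separated o q
  separated-weakenˡ o≤p (i , p<i , i≤q , cut-i) = i , ≤-<-trans o≤p p<i , i≤q , cut-i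

  separated-weakenʳ : ∀ {p q r} → q ≤ r → Separated p q → Separated p r
  separated-weakenʳ q≤r (i , p<i , i≤q , cut-i) = i , p<i , ≤-trans i≤q q≤r , cut-i

  separated-or-cutFree : ∀ p q → Separated p q ⊎ CutFree p q
  separated-or-cutFree p q with p <? blockStart q | blockStart-isCut q
  ... | yes p<s | inj₂ cut-s = inj₁ (blockStart q , p<s , blockStart-≤ q , cut-s)
  ... | yes p<s | inj₁ s≡0   = ⊥-elim (n≮0 (subst (p <_) s≡0 p<s))
  ... | no  p≮s | _          = inj₂ λ p<j j≤q → blockStart-cutFree q (≤-<-trans (≮⇒≥ p≮s) p<j) j≤q

  RespectsCuts : (ℕ → ℕ) → Set
  RespectsCuts f = ∀ {p q} → p < q → q < n →
    (Separated p q → f p < f q) × (CutFree p q → f q < f p)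

  layered-respectsCuts : RespectsCuts layered
  layered-respectsCuts p<q _ = layered-separated , layered-cutFree p<q

  module _ {f : ℕ → ℕ} (respects : RespectsCuts f) where

    respectsCuts-separated : ∀ {p q} → p < q → q < n → f p < f q → Separated p q
    respectsCuts-separated {p} {q} p<q q<n fp<fq with separated-or-cutFree p q
    ... | inj₁ separated = separated
    ... | inj₂ cutFree   = ⊥-elim (<-asym fp<fq (proj₂ (respects p<q q<n) cutFree))

    respectsCuts-cutFree : ∀ {p q} → p < q → q < n → f q < f p → CutFree p q
    respectsCuts-cutFree {p} {q} p<q q<n fq<fp with separated-or-cutFree p q
    ... | inj₁ separated = ⊥-elim (<-asym fq<fp (proj₁ (respects p<q q<n) separated))
    ... | inj₂ cutFree   = cutFree

    respectsCuts-avoids231 : Avoids n Pattern231 f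
    respectsCuts-avoids231 a<b b<c c<n (fc<fa , fa<fb) =
      <-asym fc<fa (proj₁ (respects (<-trans a<b b<c) c<n)
        (separated-weakenʳ (<⇒≤ b<c) (respectsCuts-separated a<b (<-trans b<c c<n) fa<fb)))

    respectsCuts-avoids312 : Avoids n Pattern312 f
    respectsCuts-avoids312 a<b b<c c<n (fb<fc , fc<fa) =
      <-asym fc<fa (proj₁ (respects (<-trans a<b b<c) c<n)
        (separated-weakenˡ (<⇒≤ a<b) (respectsCuts-separated b<c c<n fb<fc)))

  respectsCuts-sameOrder : ∀ {f g} → RespectsCuts f → RespectsCuts g →
    ∀ {a b} → a < n → b < n → f a < f b → g a < g b
  respectsCuts-sameOrder {f} {g} f-respects g-respects {a} {b} a<n b<n fa<fb with <-cmp a b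
  ... | tri< a<b _ _ = proj₁ (g-respects a<b b<n) (respectsCuts-separated f-respects a<b b<n fa<fb)
  ... | tri≈ _ refl _ = ⊥-elim (<-irrefl refl fa<fb)
  ... | tri> _ _ b<a = proj₂ (g-respects b<a a<n) (respectsCuts-cutFree f-respects b<a a<n fa<fb)

  -- f orders [0, n) like layered does, so f ∘ layered is strictly increasing on [0, n), hence
  -- the identity; as layered is an involution, f = layered.
  respectsCuts-unique : ∀ {f} → RespectsCuts f → (∀ {x} → x < n → f x < n) →
    ∀ {p} → p < n → f p ≡ layered p
  respectsCuts-unique {f} respects bounded {p} p<n = begin
    f p                     ≡⟨ cong f (layered-involutive p) ⟨
    f (layered (layered p)) ≡⟨ strictlyIncreasing-selfMap-id (f ∘ layered) increasing
                                 (bounded ∘ layered-<) (layered-< p<n) ⟩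
    layered p               ∎
    where
    open ≡-Reasoning
    increasing : ∀ {x y} → x < y → y < n → f (layered x) < f (layered y)
    increasing {x} {y} x<y y<n =
      respectsCuts-sameOrder layered-respectsCuts respects (layered-< (<-trans x<y y<n)) (layered-< y<n)
        (subst₂ _<_ (sym (layered-involutive x)) (sym (layered-involutive y)) x<y)

  module _ {f : ℕ → ℕ} (injective : InjectiveBelow n f)
           (avoids231 : Avoids n Pattern231 f) (avoids312 : Avoids n Pattern312 f)
           (cut≡ascent : ∀ {i} → suc i < n → cut (suc i) ≡ ascentAt f (suc i)) where

    ascent-at : ∀ {i} → suc i < n → cut (suc i) ≡ true → f i < f (suc i)
    ascent-at {i} 1+i<n cut-1+i with f i <? f (suc i)
    ... | yes fi<f[1+i] = fi<f[1+i]
    ... | no  fi≮f[1+i] with () ← trans (sym cut-1+i) (trans (cut≡ascent 1+i<n) (dec-false (_ <? _) fi≮f[1+i]))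

    descent-at : ∀ {i} → suc i < n → cut (suc i) ≡ false → f (suc i) < f i
    descent-at {i} 1+i<n no-cut with <-cmp (f i) (f (suc i))
    ... | tri< fi<f[1+i] _ _ with () ← trans (sym no-cut) (trans (cut≡ascent 1+i<n) (dec-true (_ <? _) fi<f[1+i]))
    ... | tri≈ _ fi≡f[1+i] _ = ⊥-elim (<-irrefl (injective (<-trans (n<1+n i) 1+i<n) 1+i<n fi≡f[1+i]) (n<1+n i))
    ... | tri> _ _ f[1+i]<fi = f[1+i]<fi

    -- If f q < f p, then p, j+1, q is a 231 or p, j, j+1 is a 312.
    ascent-spreads : ∀ {p j q} → p ≤ j → suc j ≤ q → q < n → f j < f (suc j) → f p < f q
    ascent-spreads {p} {j} {q} p≤j 1+j≤q q<n fj<f[1+j] with <-cmp (f p) (f q)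
    ... | tri< fp<fq _ _ = fp<fq
    ... | tri≈ _ fp≡fq _ =
      let p<q = ≤-<-trans p≤j 1+j≤q in ⊥-elim (<-irrefl (injective (<-trans p<q q<n) q<n fp≡fq) p<q)
    ... | tri> _ _ fq<fp with <-cmp (f p) (f (suc j)) | m≤n⇒m<n∨m≡n 1+j≤q | m≤n⇒m<n∨m≡n p≤j
    ...   | tri< fp<f[1+j] _ _ | inj₁ 1+j<q | _ = ⊥-elim (avoids231 (s≤s p≤j) 1+j<q q<n (fq<fp , fp<f[1+j]))
    ...   | tri< fp<f[1+j] _ _ | inj₂ refl  | _ = ⊥-elim (<-asym fp<f[1+j] fq<fp)
    ...   | tri≈ _ fp≡f[1+j] _ | _ | _ =
      let 1+j<n = ≤-<-trans 1+j≤q q<n in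
      ⊥-elim (<⇒≱ (s≤s p≤j)
        (≤-reflexive (injective 1+j<n (≤-<-trans p≤j (<-trans (n<1+n j) 1+j<n)) (sym fp≡f[1+j]))))
    ...   | tri> _ _ f[1+j]<fp | _ | inj₁ p<j =
      ⊥-elim (avoids312 p<j (n<1+n j) (≤-<-trans 1+j≤q q<n) (fj<f[1+j] , f[1+j]<fp))
    ...   | tri> _ _ f[1+j]<fp | _ | inj₂ refl = ⊥-elim (<-asym fj<f[1+j] f[1+j]<fp)

    descents-chain : ∀ {p} q → p < q → q < n → CutFree p q → f q < f p
    descents-chain (suc q) p<1+q 1+q<n cutFree with m≤n⇒m<n∨m≡n (≤-pred p<1+q)
    ... | inj₂ refl = descent-at 1+q<n (cutFree p<1+q ≤-refl)
    ... | inj₁ p<q  = <-trans (descent-at 1+q<n (cutFree p<1+q ≤-refl))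
                        (descents-chain q p<q (<-trans (n<1+n q) 1+q<n)
                          (λ p<j j≤q → cutFree p<j (m≤n⇒m≤1+n j≤q)))

    avoider-respectsCuts : RespectsCuts f
    avoider-respectsCuts {p} {q} p<q q<n = ascending , descents-chain q p<q q<n
      where
      ascending : Separated p q → f p < f q
      ascending (suc j , p<1+j , 1+j≤q , cut-1+j) =
        ascent-spreads (≤-pred p<1+j) 1+j≤q q<n (ascent-at (≤-<-trans 1+j≤q q<n) cut-1+j)

lookupℕ : ∀ {A : Set} {k} → A → Vec A k → ℕ → A
lookupℕ d []       _       = d
lookupℕ d (x ∷ xs) zero    = x
lookupℕ d (x ∷ xs) (suc p) = lookupℕ d xs p

module _ {A : Set} (d : A) where

  lookupℕ-toℕ : ∀ {k} (xs : Vec A k) i → lookupℕ d xs (toℕ i) ≡ lookup xs i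
  lookupℕ-toℕ (x ∷ xs) F.zero    = refl
  lookupℕ-toℕ (x ∷ xs) (F.suc i) = lookupℕ-toℕ xs i

  lookupℕ-beyond : ∀ {k} (xs : Vec A k) {p} → k ≤ p → lookupℕ d xs p ≡ d
  lookupℕ-beyond []       _         = refl
  lookupℕ-beyond (x ∷ xs) (s≤s k≤p) = lookupℕ-beyond xs k≤p

  lookupℕ-tabulate : ∀ {k} (g : ℕ → A) {p} → p < k → lookupℕ d (tabulate {n = k} (g ∘ toℕ)) p ≡ g p
  lookupℕ-tabulate {suc k} g {zero}  _         = refl
  lookupℕ-tabulate {suc k} g {suc p} (s≤s p<k) = lookupℕ-tabulate (g ∘ suc) p<k

  lookupℕ-ext : ∀ {k} {xs ys : Vec A k} →
    (∀ {p} → p < k → lookupℕ d xs p ≡ lookupℕ d ys p) → xs ≡ ys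
  lookupℕ-ext {xs = []}     {[]}     _  = refl
  lookupℕ-ext {xs = x ∷ xs} {y ∷ ys} eq = cong₂ _∷_ (eq z<s) (lookupℕ-ext (eq ∘ s<s))

valueAt : ∀ {m k} → Vec (Fin m) k → ℕ → ℕ
valueAt w = lookupℕ 0 (map toℕ w)

valueAt-toℕ : ∀ {m k} (w : Vec (Fin m) k) i → valueAt w (toℕ i) ≡ toℕ (lookup w i)
valueAt-toℕ w i = trans (lookupℕ-toℕ 0 (map toℕ w) i) (lookup-map i toℕ w)

valueAt-fromℕ< : ∀ {m k} (w : Vec (Fin m) k) {p} (p<k : p < k) → valueAt w p ≡ toℕ (lookup w (fromℕ< p<k))
valueAt-fromℕ< w p<k = trans (cong (valueAt w) (sym (toℕ-fromℕ< p<k))) (valueAt-toℕ w (fromℕ< p<k))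

valueAt-< : ∀ {m k} (w : Vec (Fin m) k) {p} → p < k → valueAt w p < m
valueAt-< w p<k = subst (_< _) (sym (valueAt-fromℕ< w p<k)) (toℕ<n _)

valueAt-ext : ∀ {m k} {w w′ : Vec (Fin m) k} → (∀ {p} → p < k → valueAt w p ≡ valueAt w′ p) → w ≡ w′
valueAt-ext {w = []}    {[]}      _  = refl
valueAt-ext {w = x ∷ w} {y ∷ w′} eq = cong₂ _∷_ (toℕ-injective (eq z<s)) (valueAt-ext (eq ∘ s<s))

isPerm⇒valueAt-injective : ∀ {n} (w : Vec (Fin n) n) → IsPerm w → InjectiveBelow n (valueAt w)
isPerm⇒valueAt-injective w isPerm {a} {b} a<n b<n eq = begin
  a                  ≡⟨ toℕ-fromℕ< a<n ⟨
  toℕ (fromℕ< a<n)   ≡⟨ cong toℕ (VecUnique.lookup-injective isPerm _ _ (toℕ-injective (begin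
    toℕ (lookup w (fromℕ< a<n))  ≡⟨ valueAt-fromℕ< w a<n ⟨
    valueAt w a                  ≡⟨ eq ⟩
    valueAt w b                  ≡⟨ valueAt-fromℕ< w b<n ⟩
    toℕ (lookup w (fromℕ< b<n))  ∎))) ⟩
  toℕ (fromℕ< b<n)   ≡⟨ toℕ-fromℕ< b<n ⟩
  b                  ∎
  where open ≡-Reasoning

subst₃ : ∀ (P : ℕ → ℕ → ℕ → Set) {x x′ y y′ z z′} →
  x ≡ x′ → y ≡ y′ → z ≡ z′ → P x y z → P x′ y′ z′
subst₃ P refl refl refl p = p

-- Contains231 w and Contains312 w unfold to Occurs Pattern231 w and Occurs Pattern312 w.
Occurs : ∀ {m k} → (ℕ → ℕ → ℕ → Set) → Vec (Fin m) k → Set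
Occurs {k = k} P w = ∃ λ (a : Fin k) → ∃ λ b → ∃ λ c →
  a F.< b × b F.< c × P (toℕ (lookup w a)) (toℕ (lookup w b)) (toℕ (lookup w c))

module _ {m k} (P : ℕ → ℕ → ℕ → Set) (w : Vec (Fin m) k) where

  avoids⇒¬occurs : Avoids k P (valueAt w) → ¬ Occurs P w
  avoids⇒¬occurs avoids (a , b , c , a<b , b<c , occ) =
    avoids a<b b<c (toℕ<n c)
      (subst₃ P (sym (valueAt-toℕ w a)) (sym (valueAt-toℕ w b)) (sym (valueAt-toℕ w c)) occ)

  ¬occurs⇒avoids : ¬ Occurs P w → Avoids k P (valueAt w)
  ¬occurs⇒avoids ¬occ {a} {b} {c} a<b b<c c<k =
    ¬occ ∘ λ occ → fromℕ< a<k , fromℕ< b<k , fromℕ< c<k ,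
      subst₂ _<_ (sym (toℕ-fromℕ< a<k)) (sym (toℕ-fromℕ< b<k)) a<b ,
      subst₂ _<_ (sym (toℕ-fromℕ< b<k)) (sym (toℕ-fromℕ< c<k)) b<c ,
      subst₃ P (valueAt-fromℕ< w a<k) (valueAt-fromℕ< w b<k) (valueAt-fromℕ< w c<k) occ
    where
    b<k = <-trans b<c c<k
    a<k = <-trans a<b b<k

avoids-cong : ∀ {n P f g} → (∀ {p} → p < n → f p ≡ g p) → Avoids n P f → Avoids n P g
avoids-cong {P = P} f≗g avoids a<b b<c c<n =
  avoids a<b b<c c<n ∘ subst₃ P (sym (f≗g a<n)) (sym (f≗g b<n)) (sym (f≗g c<n))
  where
  b<n = <-trans b<c c<n
  a<n = <-trans a<b b<n

supersets : ∀ {k} → Vec Bool k → List (Vec Bool k)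
supersets []          = [] ∷ []
supersets (true ∷ m)  = List.map (true ∷_) (supersets m)
supersets (false ∷ m) = List.map (false ∷_) (supersets m) List.++ List.map (true ∷_) (supersets m)

falses : ∀ {k} → Vec Bool k → ℕ
falses []          = 0
falses (true ∷ m)  = falses m
falses (false ∷ m) = suc (falses m)

falses-++ : ∀ {k l} (xs : Vec Bool k) (ys : Vec Bool l) → falses (xs ++ ys) ≡ falses xs + falses ys
falses-++ []           ys = refl
falses-++ (true ∷ xs)  ys = falses-++ xs ys
falses-++ (false ∷ xs) ys = cong suc (falses-++ xs ys)

length-supersets : ∀ {k} (m : Vec Bool k) → length (supersets m) ≡ 2 ^ falses m
length-supersets []          = refl
length-supersets (true ∷ m)  = trans (length-map _ (supersets m)) (length-supersets m)
length-supersets (false ∷ m) = begin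
  length (List.map (false ∷_) (supersets m) List.++ List.map (true ∷_) (supersets m))
    ≡⟨ length-++ (List.map (false ∷_) (supersets m)) ⟩
  length (List.map (false ∷_) (supersets m)) + length (List.map (true ∷_) (supersets m))
    ≡⟨ cong₂ _+_ (length-map _ (supersets m)) (length-map _ (supersets m)) ⟩
  length (supersets m) + length (supersets m)
    ≡⟨ cong₂ _+_ (length-supersets m) (trans (length-supersets m) (sym (+-identityʳ _))) ⟩
  2 ^ falses m + (2 ^ falses m + 0) ∎
  where open ≡-Reasoning

supersets-unique : ∀ {k} (m : Vec Bool k) → ListUnique.Unique (supersets m)
supersets-unique []          = [] ∷ []
supersets-unique (true ∷ m)  = ListUnique.map⁺ ∷-injectiveʳ (supersets-unique m)
supersets-unique (false ∷ m) =
  ListUnique.++⁺ (ListUnique.map⁺ ∷-injectiveʳ (supersets-unique m))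
                 (ListUnique.map⁺ ∷-injectiveʳ (supersets-unique m)) disjoint
  where
  disjoint : ∀ {c} → ¬ (c ∈ List.map (false ∷_) (supersets m) × c ∈ List.map (true ∷_) (supersets m))
  disjoint (c∈falses , c∈trues) with ∈-map⁻ _ c∈falses | ∈-map⁻ _ c∈trues
  ... | _ , _ , refl | _ , _ , ()

≤-true : ∀ {b c} → b Bool.≤ c → b ≡ true → c ≡ true
≤-true b≤b refl = refl

≤-fromTrue : ∀ {b c} → (b ≡ true → c ≡ true) → b Bool.≤ c
≤-fromTrue {false} {false} _ = b≤b
≤-fromTrue {false} {true}  _ = f≤t
≤-fromTrue {true}  c≡true rewrite c≡true refl = b≤b

∈-supersets⁻ : ∀ {k} (m : Vec Bool k) {c} → c ∈ supersets m → Pointwise Bool._≤_ m c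
∈-supersets⁻ []          (here refl) = []
∈-supersets⁻ (true ∷ m)  c∈ with ∈-map⁻ _ c∈
... | _ , c′∈ , refl = b≤b ∷ ∈-supersets⁻ m c′∈
∈-supersets⁻ (false ∷ m) c∈ with ∈-++⁻ (List.map (false ∷_) (supersets m)) c∈
... | inj₁ c∈falses with ∈-map⁻ _ c∈falses
...   | _ , c′∈ , refl = b≤b ∷ ∈-supersets⁻ m c′∈
∈-supersets⁻ (false ∷ m) c∈ | inj₂ c∈trues with ∈-map⁻ _ c∈trues
...   | _ , c′∈ , refl = f≤t ∷ ∈-supersets⁻ m c′∈

∈-supersets⁺ : ∀ {k} {m c : Vec Bool k} → Pointwise Bool._≤_ m c → c ∈ supersets m
∈-supersets⁺ []               = here refl
∈-supersets⁺ (b≤b {true} ∷ m≤c)  = ∈-map⁺ _ (∈-supersets⁺ m≤c)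
∈-supersets⁺ (b≤b {false} ∷ m≤c) = ∈-++⁺ˡ (∈-map⁺ _ (∈-supersets⁺ m≤c))
∈-supersets⁺ {m = _ ∷ m} (f≤t ∷ m≤c) =
  ∈-++⁺ʳ (List.map (false ∷_) (supersets m)) (∈-map⁺ _ (∈-supersets⁺ m≤c))

module Words (n : ℕ) where

  wordOf : (f : ℕ → ℕ) → (∀ {p} → p < n → f p < n) → Vec (Fin n) n
  wordOf f bounded = tabulate λ i → fromℕ< (bounded (toℕ<n i))

  module _ {f : ℕ → ℕ} (bounded : ∀ {p} → p < n → f p < n) where

    valueAt-wordOf : ∀ {p} → p < n → valueAt (wordOf f bounded) p ≡ f p
    valueAt-wordOf {p} p<n = begin
      valueAt (wordOf f bounded) p          ≡⟨ valueAt-fromℕ< (wordOf f bounded) p<n ⟩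
      toℕ (lookup (wordOf f bounded) i)     ≡⟨ cong toℕ (lookup∘tabulate _ i) ⟩
      toℕ (fromℕ< (bounded (toℕ<n i)))      ≡⟨ toℕ-fromℕ< _ ⟩
      f (toℕ i)                             ≡⟨ cong f (toℕ-fromℕ< p<n) ⟩
      f p                                   ∎
      where
      open ≡-Reasoning
      i = fromℕ< p<n

    wordOf-isPerm : (∀ {a b} → f a ≡ f b → a ≡ b) → IsPerm (wordOf f bounded)
    wordOf-isPerm injective = VecUnique.tabulate⁺ λ {i} {j} eq → toℕ-injective (injective (begin
      f (toℕ i)                         ≡⟨ toℕ-fromℕ< _ ⟨
      toℕ (fromℕ< (bounded (toℕ<n i)))  ≡⟨ cong toℕ eq ⟩
      toℕ (fromℕ< (bounded (toℕ<n j)))  ≡⟨ toℕ-fromℕ< _ ⟩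
      f (toℕ j)                         ∎))
      where open ≡-Reasoning

    wordOf-avoids : ∀ {P} → Avoids n P f → ¬ Occurs P (wordOf f bounded)
    wordOf-avoids {P} avoids =
      avoids⇒¬occurs P (wordOf f bounded) (avoids-cong {P = P} (sym ∘ valueAt-wordOf) avoids)

  cutAt : Vec Bool n → ℕ → Bool
  cutAt = lookupℕ true

  module Cuts (c : Vec Bool n) = Layered n (cutAt c) (lookupℕ-beyond true c)

  layeredWord : Vec Bool n → Vec (Fin n) n
  layeredWord c = wordOf (Cuts.layered c) (Cuts.layered-< c)

  toℕ-lookup-layeredWord : ∀ c i → toℕ (lookup (layeredWord c) i) ≡ Cuts.layered c (toℕ i)
  toℕ-lookup-layeredWord c i =
    trans (sym (valueAt-toℕ (layeredWord c) i)) (valueAt-wordOf (Cuts.layered-< c) (toℕ<n i))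

  layeredWord-separated : ∀ c {i j} → Cuts.Separated c (toℕ i) (toℕ j) →
    lookup (layeredWord c) i F.< lookup (layeredWord c) j
  layeredWord-separated c {i} {j} separated =
    subst₂ _<_ (sym (toℕ-lookup-layeredWord c i)) (sym (toℕ-lookup-layeredWord c j))
      (Cuts.layered-separated c separated)

  layeredWord-isPerm : ∀ c → IsPerm (layeredWord c)
  layeredWord-isPerm c = wordOf-isPerm (Cuts.layered-< c) (Cuts.layered-injective c)

  layeredWord-avoids231 : ∀ c → ¬ Contains231 (layeredWord c)
  layeredWord-avoids231 c = wordOf-avoids layered-< {Pattern231} (respectsCuts-avoids231 layered-respectsCuts)
    where open Cuts c

  layeredWord-avoids312 : ∀ c → ¬ Contains312 (layeredWord c)
  layeredWord-avoids312 c = wordOf-avoids layered-< {Pattern312} (respectsCuts-avoids312 layered-respectsCuts)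
    where open Cuts c

  ascents : Vec (Fin n) n → Vec Bool n
  ascents w = tabulate (ascentAt (valueAt w) ∘ toℕ)

  lookup-ascents : ∀ w i → lookup (ascents w) i ≡ ascentAt (valueAt w) (toℕ i)
  lookup-ascents w i = lookup∘tabulate _ i

  ascents-start : ∀ w {i} → toℕ i ≡ 0 → lookup (ascents w) i ≡ true
  ascents-start w {i} i≡0 = trans (lookup-ascents w i) (cong (ascentAt (valueAt w)) i≡0)

  ascents-ascent : ∀ w {i j} → toℕ j ≡ suc (toℕ i) → lookup w i F.< lookup w j →
    lookup (ascents w) j ≡ true
  ascents-ascent w {i} {j} j≡1+i wi<wj = begin
    lookup (ascents w) j                                  ≡⟨ lookup-ascents w j ⟩
    ascentAt (valueAt w) (toℕ j)                          ≡⟨ cong (ascentAt (valueAt w)) j≡1+i ⟩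
    does (valueAt w (toℕ i) <? valueAt w (suc (toℕ i)))   ≡⟨ dec-true (_ <? _) ascent ⟩
    true                                                  ∎
    where
    open ≡-Reasoning
    ascent : valueAt w (toℕ i) < valueAt w (suc (toℕ i))
    ascent = subst₂ _<_ (sym (valueAt-toℕ w i)) (trans (sym (valueAt-toℕ w j)) (cong (valueAt w) j≡1+i)) wi<wj

  ascents-layeredWord : ∀ c → cutAt c 0 ≡ true → ascents (layeredWord c) ≡ c
  ascents-layeredWord c cut-0 = lookupℕ-ext true λ {p} p<n →
    trans (lookupℕ-tabulate true (ascentAt (valueAt (layeredWord c))) p<n) (ascentIsCut p<n)
    where
    open Cuts c
    ascentIsCut : ∀ {p} → p < n → ascentAt (valueAt (layeredWord c)) p ≡ cutAt c p
    ascentIsCut {zero}  _     = sym cut-0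
    ascentIsCut {suc i} 1+i<n = begin
      ascentAt (valueAt (layeredWord c)) (suc i)
        ≡⟨ cong₂ (λ x y → does (x <? y)) (valueAt-wordOf layered-< (<-trans (n<1+n i) 1+i<n))
                                          (valueAt-wordOf layered-< 1+i<n) ⟩
      ascentAt layered (suc i)
        ≡⟨ layered-ascentAt i ⟩
      cutAt c (suc i) ∎
      where open ≡-Reasoning

  layeredWord-ascents : ∀ w → IsPerm w → ¬ Contains231 w → ¬ Contains312 w → layeredWord (ascents w) ≡ w
  layeredWord-ascents w isPerm no231 no312 = valueAt-ext λ p<n →
    trans (valueAt-wordOf layered-< p<n) (sym (respectsCuts-unique respects (valueAt-< w) p<n))
    where
    open Cuts (ascents w)
    respects : RespectsCuts (valueAt w)
    respects = avoider-respectsCuts (isPerm⇒valueAt-injective w isPerm)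
      (¬occurs⇒avoids Pattern231 w no231) (¬occurs⇒avoids Pattern312 w no312)
      (λ 1+i<n → lookupℕ-tabulate true (ascentAt (valueAt w)) 1+i<n)

module _ {a b} (k : Fin a) {x y : Fin b} where

  toℕ-combine-< : toℕ x < toℕ y → toℕ (combine k x) < toℕ (combine k y)
  toℕ-combine-< x<y = subst₂ _<_ (sym (toℕ-combine k x)) (sym (toℕ-combine k y)) (+-monoʳ-< (b * toℕ k) x<y)

  toℕ-combine-≤ : toℕ x ≤ toℕ y → toℕ (combine k x) ≤ toℕ (combine k y)
  toℕ-combine-≤ x≤y = subst₂ _≤_ (sym (toℕ-combine k x)) (sym (toℕ-combine k y)) (+-monoʳ-≤ (b * toℕ k) x≤y)

  toℕ-combine-suc : toℕ y ≡ suc (toℕ x) → toℕ (combine k y) ≡ suc (toℕ (combine k x))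
  toℕ-combine-suc y≡1+x = begin
    toℕ (combine k y)          ≡⟨ toℕ-combine k y ⟩
    b * toℕ k + toℕ y          ≡⟨ cong (b * toℕ k +_) y≡1+x ⟩
    b * toℕ k + suc (toℕ x)    ≡⟨ +-suc (b * toℕ k) (toℕ x) ⟩
    suc (b * toℕ k + toℕ x)    ≡⟨ cong suc (toℕ-combine k x) ⟨
    suc (toℕ (combine k x))    ∎
    where open ≡-Reasoning

replicate∷ʳ-last : ∀ {m} → lookup (replicate m false ∷ʳ true) (F.fromℕ m) ≡ true
replicate∷ʳ-last {zero}  = refl
replicate∷ʳ-last {suc m} = replicate∷ʳ-last {m}

replicate∷ʳ-true : ∀ {m} (y : Fin (suc m)) → lookup (replicate m false ∷ʳ true) y ≡ true → toℕ y ≡ m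
replicate∷ʳ-true {zero}  F.zero    _ = refl
replicate∷ʳ-true {suc m} (F.suc y) e = cong suc (replicate∷ʳ-true y e)

falses-replicate∷ʳ : ∀ m → falses (replicate m false ∷ʳ true) ≡ m
falses-replicate∷ʳ zero    = refl
falses-replicate∷ʳ (suc m) = cong suc (falses-replicate∷ʳ m)

module Diamonds (m : ℕ) where

  v : ℕ
  v = 3 + m

  closingCut : Vec Bool (suc m)
  closingCut = replicate m false ∷ʳ true

  -- A cut is forced at slots 1 and v-1; the Bool marks slot 0 as well, which is
  -- done for the first diamond only, since position 0 of an ascent vector is always set.
  diamondCuts : Bool → Vec Bool v
  diamondCuts b = b ∷ true ∷ closingCut

  forcedCuts : Bool → (d : ℕ) → Vec Bool (d * v)
  forcedCuts b zero    = []
  forcedCuts b (suc d) = diamondCuts b ++ forcedCuts false d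

  ForcedSlot : Fin v → Set
  ForcedSlot x = toℕ x ≡ 1 ⊎ toℕ x ≡ v ∸ 1

  diamondCuts-forced : ∀ b {x} → ForcedSlot x → lookup (diamondCuts b) x ≡ true
  diamondCuts-forced b {F.zero}          (inj₁ ())
  diamondCuts-forced b {F.zero}          (inj₂ ())
  diamondCuts-forced b {F.suc F.zero}    _        = refl
  diamondCuts-forced b {F.suc (F.suc y)} (inj₂ e) =
    subst (λ z → lookup closingCut z ≡ true)
      (toℕ-injective (trans (toℕ-fromℕ m) (sym (suc-injective (suc-injective e)))))
      (replicate∷ʳ-last {m})

  diamondCuts-true : ∀ b x → lookup (diamondCuts b) x ≡ true → (b ≡ true × toℕ x ≡ 0) ⊎ ForcedSlot x
  diamondCuts-true b F.zero            b≡true = inj₁ (b≡true , refl)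
  diamondCuts-true b (F.suc F.zero)    _      = inj₂ (inj₁ refl)
  diamondCuts-true b (F.suc (F.suc y)) e      = inj₂ (inj₂ (cong (suc ∘ suc) (replicate∷ʳ-true y e)))

  forcedCuts-forced : ∀ b d (k : Fin d) {x} → ForcedSlot x → lookup (forcedCuts b d) (combine k x) ≡ true
  forcedCuts-forced b (suc d) F.zero    {x} slot =
    trans (lookup-++ˡ (diamondCuts b) (forcedCuts false d) x) (diamondCuts-forced b slot)
  forcedCuts-forced b (suc d) (F.suc k) {x} slot =
    trans (lookup-++ʳ (diamondCuts b) (forcedCuts false d) (combine k x)) (forcedCuts-forced false d k slot)

  forcedCuts-true : ∀ b d (k : Fin d) x → lookup (forcedCuts b d) (combine k x) ≡ true →
                    (b ≡ true × toℕ (combine k x) ≡ 0) ⊎ ForcedSlot x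
  forcedCuts-true b (suc d) F.zero x e
    with diamondCuts-true b x (trans (sym (lookup-++ˡ (diamondCuts b) (forcedCuts false d) x)) e)
  ... | inj₁ (b≡true , x≡0) = inj₁ (b≡true , trans (toℕ-↑ˡ x _) x≡0)
  ... | inj₂ slot           = inj₂ slot
  forcedCuts-true b (suc d) (F.suc k) x e
    with forcedCuts-true false d k x (trans (sym (lookup-++ʳ (diamondCuts b) (forcedCuts false d) (combine k x))) e)
  ... | inj₂ slot = inj₂ slot

  falses-forcedCuts-false : ∀ d → falses (forcedCuts false d) ≡ d * suc m
  falses-forcedCuts-false zero    = refl
  falses-forcedCuts-false (suc d) = trans (falses-++ (diamondCuts false) (forcedCuts false d))
    (cong₂ _+_ (cong suc (falses-replicate∷ʳ m)) (falses-forcedCuts-false d))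

  falses-forcedCuts : ∀ d → falses (forcedCuts true (suc d)) ≡ m + d * suc m
  falses-forcedCuts d = trans (falses-++ (diamondCuts true) (forcedCuts false d))
    (cong₂ _+_ (falses-replicate∷ʳ m) (falses-forcedCuts-false d))

  forcedCuts⇒diamondLabelling : ∀ {d c} → Pointwise Bool._≤_ (forcedCuts true d) c →
    IsDiamondLabelling v d (Words.layeredWord (d * v) c)
  forcedCuts⇒diamondLabelling {d} {c} forced = layeredWord-isPerm c , leastBelowMiddle , middleBelowGreatest
    where
    open Words (d * v)
    separatedAt : ∀ k {x y z} → ForcedSlot y → toℕ x < toℕ y → toℕ y ≤ toℕ z →
                  lookup (layeredWord c) (combine k x) F.< lookup (layeredWord c) (combine k z)
    separatedAt k {y = y} slot x<y y≤z = layeredWord-separated c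
      (toℕ (combine k y) , toℕ-combine-< k x<y , toℕ-combine-≤ k y≤z ,
       trans (lookupℕ-toℕ true c (combine k y))
             (≤-true (Pointwise.lookup forced (combine k y)) (forcedCuts-forced true d k slot)))
    leastBelowMiddle : ∀ k (i j : Fin v) → toℕ i ≡ 0 → 0 < toℕ j → toℕ j < v ∸ 1 →
                       lookup (layeredWord c) (combine k i) F.< lookup (layeredWord c) (combine k j)
    leastBelowMiddle k i j i≡0 0<j _ =
      separatedAt k {y = F.suc F.zero} (inj₁ refl) (subst (_< 1) (sym i≡0) z<s) 0<j
    middleBelowGreatest : ∀ k (i j : Fin v) → 0 < toℕ i → toℕ i < v ∸ 1 → toℕ j ≡ v ∸ 1 →
                          lookup (layeredWord c) (combine k i) F.< lookup (layeredWord c) (combine k j)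
    middleBelowGreatest k i j _ i<v-1 j≡v-1 =
      separatedAt k (inj₂ j≡v-1) (subst (toℕ i <_) (sym j≡v-1) i<v-1) ≤-refl

  diamondLabelling⇒forcedCuts : ∀ {d} w → IsDiamondLabelling v d w →
    Pointwise Bool._≤_ (forcedCuts true d) (Words.ascents (d * v) w)
  diamondLabelling⇒forcedCuts {d} w (_ , leastBelowMiddle , middleBelowGreatest) =
    extensional⇒inductive (ext λ i →
      subst (λ i → lookup (forcedCuts true d) i Bool.≤ lookup (ascents w) i) (combine-remQuot {d} v i)
        (≤-fromTrue (ascentAtForced (proj₁ (remQuot {d} v i)) (proj₂ (remQuot {d} v i)))))
    where
    open Words (d * v)
    beforeGreatest : Fin v
    beforeGreatest = fromℕ< (n≤1+n (suc (suc m)))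
    toℕ-beforeGreatest : toℕ beforeGreatest ≡ suc m
    toℕ-beforeGreatest = toℕ-fromℕ< (n≤1+n (suc (suc m)))
    ascentAtForced : ∀ k x → lookup (forcedCuts true d) (combine k x) ≡ true →
                     lookup (ascents w) (combine k x) ≡ true
    ascentAtForced k x forced with forcedCuts-true true d k x forced
    ... | inj₁ (_ , start) = ascents-start w start
    ... | inj₂ (inj₁ x≡1)  = ascents-ascent w (toℕ-combine-suc k x≡1)
      (leastBelowMiddle k F.zero x refl (subst (0 <_) (sym x≡1) z<s)
        (subst (_< v ∸ 1) (sym x≡1) (s≤s (s≤s z≤n))))
    ... | inj₂ (inj₂ x≡v-1) = ascents-ascent w
      (toℕ-combine-suc k (trans x≡v-1 (cong suc (sym toℕ-beforeGreatest))))
      (middleBelowGreatest k beforeGreatest x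
        (subst (0 <_) (sym toℕ-beforeGreatest) z<s) (subst (_< v ∸ 1) (sym toℕ-beforeGreatest) ≤-refl) x≡v-1)

  layeredWord-diamond : ∀ {d c} → Pointwise Bool._≤_ (forcedCuts true d) c →
    InD-231-312 v d (Words.layeredWord (d * v) c)
  layeredWord-diamond {d} {c} forced =
    forcedCuts⇒diamondLabelling forced , layeredWord-avoids231 c , layeredWord-avoids312 c
    where open Words (d * v)

  diamondLabellings-card : ∀ d → HasCard (InD-231-312 v (suc d)) (2 ^ (m + d * suc m))
  diamondLabellings-card d = List.map layeredWord cuts , unique , membership , counted
    where
    open Words (suc d * v)
    mask : Vec Bool (suc d * v)
    mask = forcedCuts true (suc d)
    cuts : List (Vec Bool (suc d * v))
    cuts = supersets mask
    cut-0 : ∀ {c} → c ∈ cuts → cutAt c 0 ≡ true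
    cut-0 c∈cuts with ∈-supersets⁻ mask c∈cuts
    ... | b≤b ∷ _ = refl
    ascents∘layeredWord : List.map ascents (List.map layeredWord cuts) ≡ cuts
    ascents∘layeredWord = trans (sym (map-∘ cuts))
      (map-id-local (All.tabulate λ c∈cuts → ascents-layeredWord _ (cut-0 c∈cuts)))
    unique : ListUnique.Unique (List.map layeredWord cuts)
    unique = ListUnique.map⁻ (subst ListUnique.Unique (sym ascents∘layeredWord) (supersets-unique mask))
    to : ∀ {w} → w ∈ List.map layeredWord cuts → InD-231-312 v (suc d) w
    to w∈ = let c , c∈cuts , w≡ = ∈-map⁻ layeredWord w∈ in
      subst (InD-231-312 v (suc d)) (sym w≡) (layeredWord-diamond (∈-supersets⁻ mask c∈cuts))
    from : ∀ {w} → InD-231-312 v (suc d) w → w ∈ List.map layeredWord cuts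
    from {w} (labelling@(isPerm , _) , no231 , no312) =
      subst (_∈ List.map layeredWord cuts) (layeredWord-ascents w isPerm no231 no312)
        (∈-map⁺ layeredWord (∈-supersets⁺ (diamondLabelling⇒forcedCuts w labelling)))
    membership : ∀ w → (w ∈ List.map layeredWord cuts) ⇔ InD-231-312 v (suc d) w
    membership w = mk⇔ to from
    counted : length (List.map layeredWord cuts) ≡ 2 ^ (m + d * suc m)
    counted = trans (length-map layeredWord cuts)
      (trans (length-supersets mask) (cong (2 ^_) (falses-forcedCuts d)))

corollary3p11 : (v d : ℕ) → 4 ≤ v → 1 ≤ d →
    HasCard (InD-231-312 v d) (2 ^ (d * (v ∸ 2) ∸ 1))
corollary3p11 _ _ (s≤s (s≤s (s≤s (s≤s {n = v′} z≤n)))) (s≤s {n = d} z≤n) =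
  Diamonds.diamondLabellings-card (suc v′) d
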